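{- Let $m$ and $M$ be two positive integers. If $\rho (m,M)=1$, then $\mathsf{D}(\llbracket -m,M \rrbracket ) = m+M-1$.
   Context: A finite sequence of integers is an unordered finite multiset of integers; its length is its number of elements counted with multiplicity. $S=s_1\cdots s_n$ is a zero-sum sequence if $\sum s_i=0$, and minimal if moreover no non-empty proper subsequence sums to $0$. For integers $a\le b$, $\llbracket a,b\rrbracket$ is the set of integers between $a$ and $b$. $\mathsf{D}(\llbracket -m,M\rrbracket)$ is the maximal length of a minimal zero-sum sequence with all elements in $\llbracket -m,M\rrbracket$. Define $\rho(m,M)=\min\{t\in\mathbb{Z}_{\ge 0} : \exists\, t'\in\mathbb{Z},\ 0\le t'\le t,\ \gcd(M-t',\,m-(t-t'))=1\}$. -}

module Defs where

open import Data.Nat as ℕ using (ℕ; _<_; _≤_)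
open import Data.Integer as ℤ using (ℤ; +_; -_; _-_; 0ℤ)
open import Data.Integer.GCD using (gcd)
open import Data.List using (List; []; _∷_; length; foldr)
open import Data.List.Relation.Unary.All using (All)
open import Data.List.Relation.Binary.Sublist.Propositional using (_⊆_)
open import Data.Product using (Σ; ∃; ∃-syntax; _×_)
open import Relation.Binary.PropositionalEquality using (_≡_; _≢_)
open import Relation.Nullary using (¬_)

InInterval : ℤ → ℤ → ℤ → Set
InInterval a b x = (a ℤ.≤ x) × (x ℤ.≤ b)

-- Sequences (finite multisets) are represented by lists; subsequences
-- (sub-multisets) by sublists. Length counts multiplicity.
-- sum of a list of integers
sumℤ : List ℤ → ℤ
sumℤ = foldr ℤ._+_ 0ℤ

ZeroSum : List ℤ → Set
ZeroSum S = sumℤ S ≡ 0ℤ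

MinimalZeroSum : List ℤ → Set
MinimalZeroSum S =
  (S ≢ []) × ZeroSum S ×
  (∀ T → T ⊆ S → T ≢ [] → length T < length S → ¬ ZeroSum T)

MZSOver : ℕ → ℕ → List ℤ → Set
MZSOver m M S = MinimalZeroSum S × All (InInterval (- (+ m)) (+ M)) S

DavenportIs : ℕ → ℕ → ℕ → Set
DavenportIs m M d =
  (∃[ S ] (MZSOver m M S × length S ≡ d)) ×
  (∀ S → MZSOver m M S → length S ≤ d)

-- the condition defining the set whose minimum is ρ(m,M)
RhoCond : ℕ → ℕ → ℕ → Set
RhoCond m M t = ∃[ t' ] ((t' ≤ t) ×
  (gcd ((+ M) - (+ t')) ((+ m) - ((+ t) - (+ t'))) ≡ + 1))

RhoIs : ℕ → ℕ → ℕ → Set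
RhoIs m M r = RhoCond m M r × (∀ t → t < r → ¬ RhoCond m M t)

{-# OPTIONS --safe #-}
module Submission where

-- Lower bound: when gcd(M, m−1) = 1 (resp. gcd(M−1, m) = 1), the sequence
-- M^(m−1) (−(m−1))^M (resp. (M−1)^m (−m)^(M−1)) is a minimal zero-sum sequence of
-- length m+M−1 over ⟦−m, M⟧: a zero-sum subsequence p^i (−r)^j has ip = jr, and
-- coprimality of p and r forces i ∈ {0, r}.
--
-- Upper bound, when gcd(M, m) ≠ 1: order a minimal zero-sum sequence S of length n
-- greedily, starting with a chosen element e and then always adding an element whose
-- sign is opposite to the current partial sum. Minimality makes the partial sums
-- s₀ = 0, s₁ = e, …, sₙ₋₁ pairwise distinct (equal sums would cut out a proper
-- zero-sum subsequence), and they stay in ⟦1−m, M⟧, with sₖ < M for k ≥ 2. If S has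
-- an element e with −m < e < M, starting from it the value M is never reached.
-- Otherwise S consists of −m's and M's, every partial sum is a multiple of
-- gcd(M, m) ≠ 1, and so 1−m is never reached. Either way n ≤ m+M−1 by pigeonhole.

open import Defs
open import Data.Nat as ℕ using (ℕ; zero; suc; z≤n; s≤s; NonZero)
import Data.Nat.Properties as ℕ
open import Data.Nat.Divisibility using (divides; ∣⇒≤; ∣1⇒≡1)
open import Data.Nat.Coprimality as Coprime using (Coprime; coprime-divisor; gcd≡1⇒coprime; 0-coprimeTo-m⇒m≡1)
open import Data.Nat.GCD using (gcd; gcd[m,n]∣m; gcd[m,n]∣n)
open import Data.Fin as Fin using (Fin; toℕ; fromℕ<)
import Data.Fin.Properties as Fin
open import Data.List using (List; []; _∷_; length; replicate; _++_)
open import Data.List.Properties using (length-++; length-replicate)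
open import Data.List.Relation.Unary.All as All using (All; []; _∷_)
open import Data.List.Relation.Unary.All.Properties using (++⁺; replicate⁺; ¬Any⇒All¬)
open import Data.List.Relation.Unary.Any as Any using (Any; here; there)
open import Data.List.Membership.Propositional using (_∈_; find)
open import Data.List.Relation.Binary.Sublist.Propositional
  using (_⊆_; []; _∷_; _∷ʳ_; minimum; ⊆-refl; ⊆-trans; lookup)
open import Data.Product as Product using (Σ-syntax; ∃-syntax; _×_; _,_; proj₁; proj₂; map₂; uncurry)
open import Data.Sum using (_⊎_; inj₁; inj₂)
open import Function using (_∘_)
open import Relation.Nullary using (¬_; Dec; yes; no; contradiction)
open import Relation.Nullary.Decidable using (_×-dec_)
open import Relation.Unary using (Decidable)
open import Relation.Binary.PropositionalEquality

InjectiveBelow : {A : Set} → ℕ → (ℕ → A) → Set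
InjectiveBelow n f = ∀ {i j} → i ℕ.< j → j ℕ.< n → f i ≢ f j

pigeonhole-ℕ : ∀ {n B} {f : ℕ → ℕ} → InjectiveBelow n f → (∀ k → k ℕ.< n → f k ℕ.< B) → n ℕ.≤ B
pigeonhole-ℕ {n} {B} {f} f-injective f<B with n ℕ.≤? B
... | yes n≤B = n≤B
... | no n≰B =
  let i , j , i<j , gi≡gj = Fin.pigeonhole (ℕ.≰⇒> n≰B) g
  in  contradiction (trans (toℕ-g i) (trans (cong toℕ gi≡gj) (sym (toℕ-g j))))
                    (f-injective i<j (Fin.toℕ<n j))
  where
  g : Fin n → Fin B
  g i = fromℕ< (f<B (toℕ i) (Fin.toℕ<n i))
  toℕ-g : ∀ i → f (toℕ i) ≡ toℕ (g i)
  toℕ-g i = sym (Fin.toℕ-fromℕ< _)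

module _ {a} {A : Set a} where

  complement : {xs ys : List A} → xs ⊆ ys → List A
  complement []       = []
  complement (y ∷ʳ τ) = y ∷ complement τ
  complement (_ ∷ τ)  = complement τ

  complement-⊆ : {xs ys : List A} (τ : xs ⊆ ys) → complement τ ⊆ ys
  complement-⊆ []                = []
  complement-⊆ (y ∷ʳ τ)          = refl ∷ complement-⊆ τ
  complement-⊆ (_∷_ {y = y} _ τ) = y ∷ʳ complement-⊆ τ

  complement-minimum : (ys : List A) → complement (minimum ys) ≡ ys
  complement-minimum []       = refl
  complement-minimum (y ∷ ys) = cong (y ∷_) (complement-minimum ys)

  length-complement : {xs ys : List A} (τ : xs ⊆ ys) →
                      length xs ℕ.+ length (complement τ) ≡ length ys
  length-complement []            = refl
  length-complement {xs} (y ∷ʳ τ) = trans (ℕ.+-suc (length xs) _) (cong suc (length-complement τ))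
  length-complement (_ ∷ τ)       = cong suc (length-complement τ)

  include : {xs ys : List A} {x : A} (τ : xs ⊆ ys) → x ∈ complement τ → Σ[ zs ∈ List A ] zs ⊆ ys
  include {xs} (y ∷ʳ τ) (here refl)   = y ∷ xs , refl ∷ τ
  include (y ∷ʳ τ) (there x∈)         = map₂ (y ∷ʳ_) (include τ x∈)
  include (_∷_ {x = y} refl τ) x∈     = Product.map (y ∷_) (refl ∷_) (include τ x∈)

  ⊆-include : {xs ys : List A} {x : A} (τ : xs ⊆ ys) (x∈ : x ∈ complement τ) →
              xs ⊆ proj₁ (include τ x∈)
  ⊆-include (y ∷ʳ τ) (here refl) = y ∷ʳ ⊆-refl
  ⊆-include (y ∷ʳ τ) (there x∈)  = ⊆-include τ x∈
  ⊆-include (refl ∷ τ) x∈        = refl ∷ ⊆-include τ x∈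

  length-include : {xs ys : List A} {x : A} (τ : xs ⊆ ys) (x∈ : x ∈ complement τ) →
                   length (proj₁ (include τ x∈)) ≡ suc (length xs)
  length-include (y ∷ʳ τ) (here refl) = refl
  length-include (y ∷ʳ τ) (there x∈)  = length-include τ x∈
  length-include (refl ∷ τ) x∈        = cong suc (length-include τ x∈)

  ⊆-replicate-++ : ∀ {xs : List A} r (x : A) ys → xs ⊆ replicate r x ++ ys →
                   Σ[ i ∈ ℕ ] Σ[ zs ∈ List A ] i ℕ.≤ r × xs ≡ replicate i x ++ zs × zs ⊆ ys
  ⊆-replicate-++ zero    x ys τ          = 0 , _ , z≤n , refl , τ
  ⊆-replicate-++ (suc r) x ys (.x ∷ʳ τ)  =
    let i , zs , i≤r , xs≡ , σ = ⊆-replicate-++ r x ys τ in i , zs , ℕ.m≤n⇒m≤1+n i≤r , xs≡ , σ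
  ⊆-replicate-++ (suc r) x ys (refl ∷ τ) =
    let i , zs , i≤r , xs≡ , σ = ⊆-replicate-++ r x ys τ in suc i , zs , s≤s i≤r , cong (x ∷_) xs≡ , σ

  ⊆-replicate : ∀ {xs : List A} r (x : A) → xs ⊆ replicate r x → ∃[ i ] i ℕ.≤ r × xs ≡ replicate i x
  ⊆-replicate zero    x []          = 0 , z≤n , refl
  ⊆-replicate (suc r) x (.x ∷ʳ τ)  = let i , i≤r , xs≡ = ⊆-replicate r x τ in i , ℕ.m≤n⇒m≤1+n i≤r , xs≡
  ⊆-replicate (suc r) x (refl ∷ τ) = let i , i≤r , xs≡ = ⊆-replicate r x τ in suc i , s≤s i≤r , cong (x ∷_) xs≡

  length-replicate-++ : ∀ r p (x y : A) → length (replicate r x ++ replicate p y) ≡ r ℕ.+ p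
  length-replicate-++ r p x y =
    trans (length-++ (replicate r x)) (cong₂ ℕ._+_ (length-replicate r) (length-replicate p))

module _ where
  open import Data.Integer as ℤ
    using (ℤ; +_; -[1+_]; +[1+_]; -_; _+_; _-_; _*_; _≤_; _<_; 0ℤ; 1ℤ; ∣_∣; +≤+; +<+; -<+)
  import Data.Integer.Properties as ℤ
  open import Data.Integer.Divisibility.Signed using (_∣_; divides; ∣ᵤ⇒∣; ∣⇒∣ᵤ; ∣m∣n⇒∣m+n; ∣m⇒∣-m; ∣m+n∣n⇒∣m)
  import Data.Integer.GCD as ℤ
  open import Data.Integer.Tactic.RingSolver using (solve-∀)
  open import Algebra.Properties.AbelianGroup ℤ.+-0-abelianGroup
    using (xyx⁻¹≈y; //-rightDividesˡ; inverseʳ-unique; identityʳ-unique)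
  open import Algebra.Properties.CommutativeSemigroup ℤ.+-commutativeSemigroup using (x∙yz≈y∙xz)

  pigeonhole-ℤ : ∀ {n B lo} {f : ℕ → ℤ} → InjectiveBelow n f →
                 (∀ k → k ℕ.< n → lo ≤ f k × f k < lo + + B) → n ℕ.≤ B
  pigeonhole-ℤ {n} {B} {lo} {f} f-injective f-bounded = pigeonhole-ℕ offset-injective offset<B
    where
    offset : ℕ → ℕ
    offset k = ∣ f k - lo ∣
    +offset : ∀ k → k ℕ.< n → + offset k ≡ f k - lo
    +offset k k<n = ℤ.0≤i⇒+∣i∣≡i (ℤ.i≤j⇒0≤j-i (proj₁ (f-bounded k k<n)))
    offset<B : ∀ k → k ℕ.< n → offset k ℕ.< B
    offset<B k k<n = ℤ.drop‿+<+ (begin-strict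
      + offset k     ≡⟨ +offset k k<n ⟩
      f k - lo       <⟨ ℤ.+-monoˡ-< (- lo) (proj₂ (f-bounded k k<n)) ⟩
      lo + + B - lo  ≡⟨ xyx⁻¹≈y lo (+ B) ⟩
      + B            ∎)
      where open ℤ.≤-Reasoning
    offset-injective : InjectiveBelow n offset
    offset-injective {i} {j} i<j j<n eq = f-injective i<j j<n (begin
      f i              ≡⟨ //-rightDividesˡ lo (f i) ⟨
      f i - lo + lo    ≡⟨ cong (_+ lo) (+offset i (ℕ.<-trans i<j j<n)) ⟨
      + offset i + lo  ≡⟨ cong (λ o → + o + lo) eq ⟩
      + offset j + lo  ≡⟨ cong (_+ lo) (+offset j j<n) ⟩
      f j - lo + lo    ≡⟨ //-rightDividesˡ lo (f j) ⟩
      f j              ∎)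
      where open ≡-Reasoning

  sum-++ : ∀ xs ys → sumℤ (xs ++ ys) ≡ sumℤ xs + sumℤ ys
  sum-++ []       ys = sym (ℤ.+-identityˡ (sumℤ ys))
  sum-++ (x ∷ xs) ys = trans (cong (_+_ x) (sum-++ xs ys)) (sym (ℤ.+-assoc x (sumℤ xs) (sumℤ ys)))

  sum-replicate : ∀ n x → sumℤ (replicate n x) ≡ + n * x
  sum-replicate zero    x = sym (ℤ.*-zeroˡ x)
  sum-replicate (suc n) x = trans (cong (_+_ x) (sum-replicate n x)) (sym (ℤ.suc-* (+ n) x))

  sum-complement : ∀ {xs ys} (τ : xs ⊆ ys) → sumℤ xs + sumℤ (complement τ) ≡ sumℤ ys
  sum-complement []                     = refl
  sum-complement {xs} (y ∷ʳ τ)          =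
    trans (x∙yz≈y∙xz (sumℤ xs) y _) (cong (_+_ y) (sum-complement τ))
  sum-complement (_∷_ {x = y} refl τ)   =
    trans (ℤ.+-assoc y _ _) (cong (_+_ y) (sum-complement τ))

  sum-include : ∀ {xs ys x} (τ : xs ⊆ ys) (x∈ : x ∈ complement τ) →
                sumℤ (proj₁ (include τ x∈)) ≡ sumℤ xs + x
  sum-include {xs} (y ∷ʳ τ) (here refl)   = ℤ.+-comm y (sumℤ xs)
  sum-include (y ∷ʳ τ) (there x∈)         = sum-include τ x∈
  sum-include {x = x} (_∷_ {x = y} refl τ) x∈ =
    trans (cong (_+_ y) (sum-include τ x∈)) (sym (ℤ.+-assoc y _ x))

  negative-sum⇒negative : ∀ {xs} → sumℤ xs < 0ℤ → Any (_< 0ℤ) xs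
  negative-sum⇒negative {[]}     (+<+ ())
  negative-sum⇒negative {x ∷ xs} x+Σxs<0 with x ℤ.<? 0ℤ
  ... | yes x<0 = here x<0
  ... | no  x≮0 = there (negative-sum⇒negative (begin-strict
    sumℤ xs       ≡⟨ ℤ.+-identityˡ (sumℤ xs) ⟨
    0ℤ + sumℤ xs  ≤⟨ ℤ.+-monoˡ-≤ (sumℤ xs) (ℤ.≮⇒≥ x≮0) ⟩
    x + sumℤ xs   <⟨ x+Σxs<0 ⟩
    0ℤ            ∎))
    where open ℤ.≤-Reasoning

  positive-sum⇒positive : ∀ {xs} → 0ℤ < sumℤ xs → Any (0ℤ <_) xs
  positive-sum⇒positive {[]}     (+<+ ())
  positive-sum⇒positive {x ∷ xs} 0<x+Σxs with 0ℤ ℤ.<? x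
  ... | yes 0<x = here 0<x
  ... | no  0≮x = there (positive-sum⇒positive (begin-strict
    0ℤ            <⟨ 0<x+Σxs ⟩
    x + sumℤ xs   ≤⟨ ℤ.+-monoˡ-≤ (sumℤ xs) (ℤ.≮⇒≥ 0≮x) ⟩
    0ℤ + sumℤ xs  ≡⟨ ℤ.+-identityˡ (sumℤ xs) ⟩
    sumℤ xs       ∎))
    where open ℤ.≤-Reasoning

  zero-sum⇒positive : ∀ {xs} → sumℤ xs ≡ 0ℤ → xs ≢ [] → All (_≢ 0ℤ) xs → Any (0ℤ <_) xs
  zero-sum⇒positive {[]}             _    xs≢[] _           = contradiction refl xs≢[]
  zero-sum⇒positive {+ zero ∷ _}     _    _     (x≢0 ∷ _)   = contradiction refl x≢0
  zero-sum⇒positive {+[1+ _ ] ∷ _}   _    _     _           = here (+<+ (s≤s z≤n))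
  zero-sum⇒positive { -[1+ n ] ∷ xs} Σ≡0  _     _           =
    there (positive-sum⇒positive (subst (0ℤ <_) (sym (inverseʳ-unique -[1+ n ] (sumℤ xs) Σ≡0)) (+<+ (s≤s z≤n))))

  nested-sums-distinct : ∀ {S U V} → MinimalZeroSum S → (σ : U ⊆ V) → V ⊆ S →
                         length U ℕ.< length V → length V ℕ.< length S → sumℤ U ≢ sumℤ V
  nested-sums-distinct {S} {U} {V} (_ , _ , no-proper-zero-sum) σ V⊆S |U|<|V| |V|<|S| ΣU≡ΣV =
    no-proper-zero-sum (complement σ) (⊆-trans (complement-⊆ σ) V⊆S) C≢[] |C|<|S| ΣC≡0
    where
    C≢[] : complement σ ≢ []
    C≢[] C≡[] = ℕ.<-irrefl
      (trans (sym (ℕ.+-identityʳ _))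
             (subst (λ C → length U ℕ.+ length C ≡ length V) C≡[] (length-complement σ)))
      |U|<|V|
    |C|<|S| : length (complement σ) ℕ.< length S
    |C|<|S| = ℕ.≤-<-trans (subst (length (complement σ) ℕ.≤_) (length-complement σ) (ℕ.m≤n+m _ _)) |V|<|S|
    ΣC≡0 : sumℤ (complement σ) ≡ 0ℤ
    ΣC≡0 = identityʳ-unique (sumℤ U) _ (trans (sum-complement σ) (sym ΣU≡ΣV))

  -- The greedy rule; by minimality the partial sum is 0 only at the start, where e is taken.
  Next : ℤ → ℤ → ℤ → Set
  Next e (+ zero)  x = e ≡ x
  Next e +[1+ _ ]  x = x < 0ℤ
  Next e -[1+ _ ]  x = 0ℤ < x

  next? : ∀ e t → Decidable (Next e t)
  next? e (+ zero)  x = e ℤ.≟ x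
  next? e +[1+ _ ]  x = x ℤ.<? 0ℤ
  next? e -[1+ _ ]  x = 0ℤ ℤ.<? x

  next-exists : ∀ {e t xs} → t + sumℤ xs ≡ 0ℤ → t ≢ 0ℤ → Any (Next e t) xs
  next-exists {t = + zero}    _      t≢0 = contradiction refl t≢0
  next-exists {t = +[1+ n ]}  t+Σ≡0  _   =
    negative-sum⇒negative (subst (_< 0ℤ) (sym (inverseʳ-unique +[1+ n ] _ t+Σ≡0)) -<+)
  next-exists {t = -[1+ n ]}  t+Σ≡0  _   =
    positive-sum⇒positive (subst (0ℤ <_) (sym (inverseʳ-unique -[1+ n ] _ t+Σ≡0)) (+<+ (s≤s z≤n)))

  next-bounded : ∀ {m M e t x} → 1ℤ - + m ≤ t → t ≤ + M → t ≢ 0ℤ →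
                 InInterval (- + m) (+ M) x → Next e t x → 1ℤ - + m ≤ t + x × t + x < + M
  next-bounded {t = + zero} _ _ t≢0 _ _ = contradiction refl t≢0
  next-bounded {m} {M} {t = t@(+[1+ _ ])} {x} _ t≤M _ (-m≤x , _) x<0 =
    ℤ.+-mono-≤ (+≤+ (s≤s z≤n)) -m≤x ,
    (begin-strict
      t + x   <⟨ ℤ.+-monoʳ-< t x<0 ⟩
      t + 0ℤ  ≡⟨ ℤ.+-identityʳ t ⟩
      t       ≤⟨ t≤M ⟩
      + M     ∎)
    where open ℤ.≤-Reasoning
  next-bounded {m} {M} {t = t@(-[1+ _ ])} {x} 1-m≤t _ _ (_ , x≤M) 0<x =
    (begin
      1ℤ - + m  ≤⟨ 1-m≤t ⟩
      t         ≡⟨ ℤ.+-identityʳ t ⟨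
      t + 0ℤ    ≤⟨ ℤ.+-monoʳ-≤ t (ℤ.<⇒≤ 0<x) ⟩
      t + x     ∎) ,
    (begin-strict
      t + x     <⟨ ℤ.+-monoˡ-< x -<+ ⟩
      0ℤ + x    ≡⟨ ℤ.+-identityˡ x ⟩
      x         ≤⟨ x≤M ⟩
      + M       ∎)
    where open ℤ.≤-Reasoning

  record BalancedWalk (S : List ℤ) (e : ℤ) : Set where
    field
      partial           : ℕ → ℤ
      partial-zero      : partial 0 ≡ 0ℤ
      partial-suc       : ∀ k → k ℕ.< length S →
                          ∃[ x ] x ∈ S × Next e (partial k) x × partial (suc k) ≡ partial k + x
      partial-injective : InjectiveBelow (length S) partial

  module GreedyWalk (S : List ℤ) (e : ℤ) where

    Extension : List ℤ → List ℤ → Set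
    Extension T T′ = ∃[ x ] x ∈ S × Next e (sumℤ T) x × sumℤ T′ ≡ sumℤ T + x × length T′ ≡ suc (length T)

    advance : ∀ {T} (τ : T ⊆ S) → Dec (Any (Next e (sumℤ T)) (complement τ)) → Σ[ T′ ∈ List ℤ ] T′ ⊆ S
    advance τ (yes next) = let _ , x∈ , _ = find next in include τ x∈
    advance τ (no _)     = _ , τ  -- only once S is used up (next-available)

    ⊆-advance : ∀ {T} (τ : T ⊆ S) d → T ⊆ proj₁ (advance τ d)
    ⊆-advance τ (yes next) = let _ , x∈ , _ = find next in ⊆-include τ x∈
    ⊆-advance τ (no _)     = ⊆-refl

    advance-extends : ∀ {T} (τ : T ⊆ S) d → Any (Next e (sumℤ T)) (complement τ) →
                      Extension T (proj₁ (advance τ d))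
    advance-extends τ (yes next) _ =
      let x , x∈ , x-next = find next
      in  x , lookup (complement-⊆ τ) x∈ , x-next , sum-include τ x∈ , length-include τ x∈
    advance-extends τ (no ¬next) next = contradiction next ¬next

    next-in-complement? : ∀ {T} (τ : T ⊆ S) → Dec (Any (Next e (sumℤ T)) (complement τ))
    next-in-complement? {T} τ = Any.any? (next? e (sumℤ T)) (complement τ)

    walk : ℕ → Σ[ T ∈ List ℤ ] T ⊆ S
    walk zero    = [] , minimum S
    walk (suc k) = let _ , τ = walk k in advance τ (next-in-complement? τ)

    prefix : ℕ → List ℤ
    prefix k = proj₁ (walk k)

    prefix-⊆ : ∀ k → prefix k ⊆ S
    prefix-⊆ k = proj₂ (walk k)

    partial : ℕ → ℤ
    partial k = sumℤ (prefix k)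

    prefix-⊆-suc : ∀ k → prefix k ⊆ prefix (suc k)
    prefix-⊆-suc k = ⊆-advance (prefix-⊆ k) (next-in-complement? (prefix-⊆ k))

    prefix-mono : ∀ {i j} → i ℕ.≤′ j → prefix i ⊆ prefix j
    prefix-mono ℕ.≤′-refl         = ⊆-refl
    prefix-mono (ℕ.≤′-step {j} i≤′j) = ⊆-trans (prefix-mono i≤′j) (prefix-⊆-suc j)

    walk-extends : ∀ k → Any (Next e (partial k)) (complement (prefix-⊆ k)) →
                   Extension (prefix k) (prefix (suc k))
    walk-extends k = advance-extends (prefix-⊆ k) (next-in-complement? (prefix-⊆ k))

    module _ (S-minimal : MinimalZeroSum S) (e∈S : e ∈ S) where

      next-available : ∀ k → k ℕ.< length S → length (prefix k) ≡ k →
                       Any (Next e (partial k)) (complement (prefix-⊆ k))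
      next-available zero    _   _     = subst (Any (e ≡_)) (sym (complement-minimum S)) e∈S
      next-available (suc k) k<n |T|≡k =
        next-exists (trans (sum-complement (prefix-⊆ (suc k))) (proj₁ (proj₂ S-minimal)))
                 (nested-sums-distinct S-minimal (minimum _) (prefix-⊆ (suc k))
                    (subst (0 ℕ.<_) (sym |T|≡k) (s≤s z≤n)) (subst (ℕ._< length S) (sym |T|≡k) k<n) ∘ sym)

      length-prefix : ∀ k → k ℕ.≤ length S → length (prefix k) ≡ k
      length-prefix zero    _   = refl
      length-prefix (suc k) k<n =
        let |T|≡k = length-prefix k (ℕ.<⇒≤ k<n)
            _ , _ , _ , _ , |T′|≡ = walk-extends k (next-available k k<n |T|≡k)
        in  trans |T′|≡ (cong suc |T|≡k)

      walk-balanced : BalancedWalk S e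
      walk-balanced = record
        { partial           = partial
        ; partial-zero      = refl
        ; partial-suc       = λ k k<n →
            let x , x∈S , x-next , Σ≡ , _ = walk-extends k (next-available k k<n (length-prefix k (ℕ.<⇒≤ k<n)))
            in  x , x∈S , x-next , Σ≡
        ; partial-injective = λ {i} {j} i<j j<n →
            nested-sums-distinct S-minimal (prefix-mono (ℕ.≤⇒≤′ (ℕ.<⇒≤ i<j))) (prefix-⊆ j)
              (subst₂ ℕ._<_ (sym (length-prefix i (ℕ.<⇒≤ (ℕ.<-trans i<j j<n))))
                            (sym (length-prefix j (ℕ.<⇒≤ j<n))) i<j)
              (subst (ℕ._< length S) (sym (length-prefix j (ℕ.<⇒≤ j<n))) j<n)
        }

  balancedWalk : ∀ {S e} → MinimalZeroSum S → e ∈ S → BalancedWalk S e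
  balancedWalk {S} {e} = GreedyWalk.walk-balanced S e

  1-m≤0 : ∀ {m} .{{_ : NonZero m}} → 1ℤ - + m ≤ 0ℤ
  1-m≤0 {m} = ℤ.i≤j⇒i-j≤0 (+≤+ (ℕ.>-nonZero⁻¹ m))

  module WalkBounds {m M S e} (W : BalancedWalk S e) (S-within : All (InInterval (- + m) (+ M)) S) where

    open BalancedWalk W

    partial-one : 0 ℕ.< length S → partial 1 ≡ e
    partial-one 0<n =
      let x , _ , x-next , Σ≡ = partial-suc 0 0<n
      in  begin
        partial 1      ≡⟨ Σ≡ ⟩
        partial 0 + x  ≡⟨ cong (_+ x) partial-zero ⟩
        0ℤ + x         ≡⟨ ℤ.+-identityˡ x ⟩
        x              ≡⟨ subst (λ t → Next e t x) partial-zero x-next ⟨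
        e              ∎
      where open ≡-Reasoning

    partial-advance : ∀ k → suc k ℕ.< length S → InInterval (1ℤ - + m) (+ M) (partial (suc k)) →
                      1ℤ - + m ≤ partial (suc (suc k)) × partial (suc (suc k)) < + M
    partial-advance k sk<n (1-m≤t , t≤M) =
      let x , x∈S , x-next , Σ≡ = partial-suc (suc k) sk<n
      in  subst (λ s → 1ℤ - + m ≤ s × s < + M) (sym Σ≡)
            (next-bounded 1-m≤t t≤M t≢0 (All.lookup S-within x∈S) x-next)
      where
      t≢0 : partial (suc k) ≢ 0ℤ
      t≢0 t≡0 = partial-injective (s≤s z≤n) sk<n (trans partial-zero (sym t≡0))

    module _ .{{_ : NonZero m}} (e-within : InInterval (1ℤ - + m) (+ M) e) where

      partial-within : ∀ k → k ℕ.< length S → InInterval (1ℤ - + m) (+ M) (partial k)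
      partial-within zero          _   = subst (InInterval _ _) (sym partial-zero) (1-m≤0 , +≤+ z≤n)
      partial-within (suc zero)    1<n = subst (InInterval _ _) (sym (partial-one (ℕ.<⇒≤ 1<n))) e-within
      partial-within (suc (suc k)) k<n =
        map₂ ℤ.<⇒≤ (partial-advance k (ℕ.<⇒≤ k<n) (partial-within (suc k) (ℕ.<⇒≤ k<n)))

      partial-below : .{{_ : NonZero M}} → e < + M → ∀ k → k ℕ.< length S → partial k < + M
      partial-below e<M zero          _   = subst (_< + M) (sym partial-zero) (+<+ (ℕ.>-nonZero⁻¹ M))
      partial-below e<M (suc zero)    1<n = subst (_< + M) (sym (partial-one (ℕ.<⇒≤ 1<n))) e<M
      partial-below e<M (suc (suc k)) k<n =
        proj₂ (partial-advance k (ℕ.<⇒≤ k<n) (partial-within (suc k) (ℕ.<⇒≤ k<n)))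

    partial-divisible : ∀ {d} → All (d ∣_) S → ∀ k → k ℕ.≤ length S → d ∣ partial k
    partial-divisible {d} _ zero _ = subst (d ∣_) (sym partial-zero) (divides 0ℤ (sym (ℤ.*-zeroˡ d)))
    partial-divisible d∣S (suc k) k<n =
      let x , x∈S , _ , Σ≡ = partial-suc k k<n
      in  subst (_ ∣_) (sym Σ≡) (∣m∣n⇒∣m+n (partial-divisible d∣S k (ℕ.<⇒≤ k<n)) (All.lookup d∣S x∈S))

  1-m+[m+M∸1]≡M : ∀ m M .{{_ : NonZero m}} → 1ℤ - + m + + (m ℕ.+ M ℕ.∸ 1) ≡ + M
  1-m+[m+M∸1]≡M (suc a) M = 1-[1+a]+[a+M]≡M (+ a) (+ M)
    where
    1-[1+a]+[a+M]≡M : ∀ a M → 1ℤ - (1ℤ + a) + (a + M) ≡ M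
    1-[1+a]+[a+M]≡M = solve-∀

  interior⇒length≤ : ∀ {m M S e} .{{_ : NonZero m}} .{{_ : NonZero M}} → MZSOver m M S → e ∈ S →
                      - + m < e → e < + M → length S ℕ.≤ m ℕ.+ M ℕ.∸ 1
  interior⇒length≤ {m} {M} {S} {e} (S-minimal , S-within) e∈S -m<e e<M =
    pigeonhole-ℤ partial-injective bounds
    where
    W : BalancedWalk S e
    W = balancedWalk S-minimal e∈S
    open BalancedWalk W
    open WalkBounds W S-within
    e-within : InInterval (1ℤ - + m) (+ M) e
    e-within = ℤ.i<j⇒suc[i]≤j -m<e , ℤ.<⇒≤ e<M
    bounds : ∀ k → k ℕ.< length S → 1ℤ - + m ≤ partial k × partial k < 1ℤ - + m + + (m ℕ.+ M ℕ.∸ 1)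
    bounds k k<n = proj₁ (partial-within e-within k k<n) ,
                   subst (partial k <_) (sym (1-m+[m+M∸1]≡M m M)) (partial-below e-within e<M k k<n)

  non-interior⇒extreme : ∀ {m M x} → InInterval (- + m) (+ M) x → ¬ (- + m < x × x < + M) →
                         x ≡ - + m ⊎ x ≡ + M
  non-interior⇒extreme {m} {M} {x} (-m≤x , x≤M) ¬interior with - + m ℤ.<? x
  ... | yes -m<x = inj₂ (ℤ.≤-antisym x≤M (ℤ.≮⇒≥ (¬interior ∘ (-m<x ,_))))
  ... | no  -m≮x = inj₁ (ℤ.≤-antisym (ℤ.≮⇒≥ -m≮x) -m≤x)

  extreme⇒≢0 : ∀ {m M x} .{{_ : NonZero m}} .{{_ : NonZero M}} → x ≡ - + m ⊎ x ≡ + M → x ≢ 0ℤ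
  extreme⇒≢0 {m} (inj₁ refl) -m≡0 = ℕ.≢-nonZero⁻¹ m (ℤ.+-injective (ℤ.neg-injective {j = 0ℤ} -m≡0))
  extreme⇒≢0 {M = M} (inj₂ refl) M≡0 = ℕ.≢-nonZero⁻¹ M (ℤ.+-injective M≡0)

  extremes⇒length≤ : ∀ {m M S} .{{_ : NonZero m}} .{{_ : NonZero M}} → gcd M m ≢ 1 → MZSOver m M S →
                     All (λ x → x ≡ - + m ⊎ x ≡ + M) S → length S ℕ.≤ m ℕ.+ M ℕ.∸ 1
  extremes⇒length≤ {m} {M} {S} gcd≢1 (S-minimal@(S≢[] , S-zero , _) , S-within) S-extreme
    with find (zero-sum⇒positive S-zero S≢[] (All.map extreme⇒≢0 S-extreme))
  ... | e , e∈S , 0<e = pigeonhole-ℤ partial-injective bounds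
    where
    W : BalancedWalk S e
    W = balancedWalk S-minimal e∈S
    open BalancedWalk W
    open WalkBounds W S-within
    e-within : InInterval (1ℤ - + m) (+ M) e
    e-within = ℤ.≤-trans 1-m≤0 (ℤ.<⇒≤ 0<e) , proj₂ (All.lookup S-within e∈S)
    g∣m : + gcd M m ∣ + m
    g∣m = ∣ᵤ⇒∣ (gcd[m,n]∣n M m)
    g∣S : All (+ gcd M m ∣_) S
    g∣S = All.map (λ { (inj₁ refl) → ∣m⇒∣-m g∣m ; (inj₂ refl) → ∣ᵤ⇒∣ (gcd[m,n]∣m M m) }) S-extreme
    1-m≢partial : ∀ k → k ℕ.< length S → 1ℤ - + m ≢ partial k
    1-m≢partial k k<n 1-m≡sₖ = gcd≢1 (∣1⇒≡1 (∣⇒∣ᵤ (∣m+n∣n⇒∣m {m = 1ℤ} g∣1-m (∣m⇒∣-m g∣m))))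
      where
      g∣1-m : + gcd M m ∣ 1ℤ - + m
      g∣1-m = subst (_ ∣_) (sym 1-m≡sₖ) (partial-divisible g∣S k (ℕ.<⇒≤ k<n))
    bounds : ∀ k → k ℕ.< length S →
             ℤ.suc (1ℤ - + m) ≤ partial k × partial k < ℤ.suc (1ℤ - + m) + + (m ℕ.+ M ℕ.∸ 1)
    bounds k k<n =
      let 1-m≤sₖ , sₖ≤M = partial-within e-within k k<n
      in  ℤ.i<j⇒suc[i]≤j (ℤ.≤∧≢⇒< 1-m≤sₖ (1-m≢partial k k<n)) ,
          subst (partial k <_) (sym (trans (ℤ.+-assoc 1ℤ (1ℤ - + m) _) (cong ℤ.suc (1-m+[m+M∸1]≡M m M))))
                (ℤ.suc[i]≤j⇒i<j (ℤ.suc-mono sₖ≤M))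

  gcd≢1⇒length≤ : ∀ {m M S} .{{_ : NonZero m}} .{{_ : NonZero M}} → gcd M m ≢ 1 → MZSOver m M S →
                  length S ℕ.≤ m ℕ.+ M ℕ.∸ 1
  gcd≢1⇒length≤ {m} {M} {S} gcd≢1 S-mzs with Any.any? (λ x → (- + m ℤ.<? x) ×-dec (x ℤ.<? + M)) S
  ... | yes interior = let _ , e∈S , -m<e , e<M = find interior in interior⇒length≤ S-mzs e∈S -m<e e<M
  ... | no ¬interior =
    extremes⇒length≤ gcd≢1 S-mzs
      (All.zipWith (uncurry non-interior⇒extreme) (proj₂ S-mzs , ¬Any⇒All¬ S ¬interior))

  coprime-balance : ∀ {p r i j} .{{_ : NonZero r}} → Coprime p r → i ℕ.≤ r →
                    i ℕ.* p ≡ j ℕ.* r → (i ≡ 0 × j ≡ 0) ⊎ (i ≡ r × j ≡ p)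
  coprime-balance {p} {r} {zero} {j} _ _ ip≡jr = inj₁ (refl , ℕ.m*n≡0⇒m≡0 j r (sym ip≡jr))
  coprime-balance {p} {r} {i@(suc _)} {j} p⊥r i≤r ip≡jr = inj₂ (i≡r , j≡p)
    where
    i≡r : i ≡ r
    i≡r = ℕ.≤-antisym i≤r (∣⇒≤ (coprime-divisor (Coprime.sym p⊥r) (divides j (trans (ℕ.*-comm p i) ip≡jr))))
    j≡p : j ≡ p
    j≡p = ℕ.*-cancelʳ-≡ j p r (trans (sym ip≡jr) (trans (cong (ℕ._* p) i≡r) (ℕ.*-comm r p)))

  sum-replicate-pair : ∀ i j p r →
                       sumℤ (replicate i (+ p) ++ replicate j (- + r)) ≡ + (i ℕ.* p) - + (j ℕ.* r)
  sum-replicate-pair i j p r = begin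
    sumℤ (replicate i (+ p) ++ replicate j (- + r))
      ≡⟨ sum-++ (replicate i (+ p)) _ ⟩
    sumℤ (replicate i (+ p)) + sumℤ (replicate j (- + r))
      ≡⟨ cong₂ _+_ (sum-replicate i (+ p)) (sum-replicate j (- + r)) ⟩
    + i * + p + + j * - + r
      ≡⟨ cong₂ _+_ (ℤ.pos-* i p) (ℤ.neg-distribʳ-* (+ j) (+ r)) ⟨
    + (i ℕ.* p) - + j * + r
      ≡⟨ cong (λ n → + (i ℕ.* p) - n) (ℤ.pos-* j r) ⟨
    + (i ℕ.* p) - + (j ℕ.* r)
      ∎
    where open ≡-Reasoning

  coprime⇒minimal : ∀ {p r} → Coprime p r → MinimalZeroSum (replicate r (+ p) ++ replicate p (- + r))
  coprime⇒minimal {p} {zero} p⊥0 with 0-coprimeTo-m⇒m≡1 (Coprime.sym p⊥0)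
  ... | refl = (λ ()) , refl , λ { [] _ T≢[] _ _ → T≢[] refl ; (_ ∷ _) _ _ (s≤s ()) _ }
  coprime⇒minimal {p} {r@(suc _)} p⊥r = (λ ()) , S-zero , no-proper-zero-sum
    where
    S : List ℤ
    S = replicate r (+ p) ++ replicate p (- + r)
    S-zero : ZeroSum S
    S-zero = trans (sum-replicate-pair r p p r)
                   (trans (cong (λ n → + (r ℕ.* p) - + n) (ℕ.*-comm p r)) (ℤ.+-inverseʳ (+ (r ℕ.* p))))
    no-proper-zero-sum : ∀ T → T ⊆ S → T ≢ [] → length T ℕ.< length S → ¬ ZeroSum T
    no-proper-zero-sum T T⊆S T≢[] |T|<|S| T-zero with ⊆-replicate-++ r (+ p) _ T⊆S
    ... | i , zs , i≤r , refl , zs⊆ with ⊆-replicate p (- + r) zs⊆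
    ... | j , _ , refl
      with coprime-balance {i = i} {j} p⊥r i≤r
             (ℤ.+-injective (ℤ.i-j≡0⇒i≡j _ _ (trans (sym (sum-replicate-pair i j p r)) T-zero)))
    ... | inj₁ (refl , refl) = T≢[] refl
    ... | inj₂ (refl , refl) = ℕ.<-irrefl refl |T|<|S|

  replicate-pair-within : ∀ {m M p r} → p ℕ.≤ M → r ℕ.≤ m →
                          All (InInterval (- + m) (+ M)) (replicate r (+ p) ++ replicate p (- + r))
  replicate-pair-within {p = p} {r} p≤M r≤m =
    ++⁺ (replicate⁺ r (ℤ.neg-≤-pos , +≤+ p≤M)) (replicate⁺ p (ℤ.neg-mono-≤ (+≤+ r≤m) , ℤ.neg-≤-pos))

  long-minimal-sequence : ∀ {m M} .{{_ : NonZero m}} .{{_ : NonZero M}} →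
                          Coprime M (m ℕ.∸ 1) ⊎ Coprime (M ℕ.∸ 1) m →
                          ∃[ S ] MZSOver m M S × length S ≡ m ℕ.+ M ℕ.∸ 1
  long-minimal-sequence {m} {M} (inj₁ M⊥m-1) =
    _ , (coprime⇒minimal M⊥m-1 , replicate-pair-within ℕ.≤-refl (ℕ.m∸n≤m m 1)) ,
    trans (length-replicate-++ (m ℕ.∸ 1) M _ _) (sym (ℕ.+-∸-comm M (ℕ.>-nonZero⁻¹ m)))
  long-minimal-sequence {m} {M} (inj₂ M-1⊥m) =
    _ , (coprime⇒minimal M-1⊥m , replicate-pair-within (ℕ.m∸n≤m M 1) ℕ.≤-refl) ,
    trans (length-replicate-++ m (M ℕ.∸ 1) _ _) (sym (ℕ.+-∸-assoc m (ℕ.>-nonZero⁻¹ M)))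

  +m-+n≡+[m∸n] : ∀ {m n} → n ℕ.≤ m → + m - + n ≡ + (m ℕ.∸ n)
  +m-+n≡+[m∸n] {m} {n} n≤m = trans (ℤ.m-n≡m⊖n m n) (ℤ.⊖-≥ n≤m)

  rho-gcd : ∀ {m M t t′} → t′ ℕ.≤ t → t′ ℕ.≤ M → t ℕ.∸ t′ ℕ.≤ m →
            ℤ.gcd (+ M - + t′) (+ m - (+ t - + t′)) ≡ + gcd (M ℕ.∸ t′) (m ℕ.∸ (t ℕ.∸ t′))
  rho-gcd {m} t′≤t t′≤M t-t′≤m =
    cong₂ ℤ.gcd (+m-+n≡+[m∸n] t′≤M) (trans (cong (λ d → + m - d) (+m-+n≡+[m∸n] t′≤t)) (+m-+n≡+[m∸n] t-t′≤m))

  ¬rhoCond₀⇒gcd≢1 : ∀ {m M} → ¬ RhoCond m M 0 → gcd M m ≢ 1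
  ¬rhoCond₀⇒gcd≢1 {m} {M} ¬cond gcd≡1 =
    ¬cond (0 , z≤n , trans (rho-gcd {m} {M} z≤n z≤n z≤n) (cong +_ gcd≡1))

  rhoCond₁⇒coprime : ∀ {m M} .{{_ : NonZero m}} .{{_ : NonZero M}} → RhoCond m M 1 →
                     Coprime M (m ℕ.∸ 1) ⊎ Coprime (M ℕ.∸ 1) m
  rhoCond₁⇒coprime {m} {M} (zero , _ , gcd≡1) =
    inj₁ (gcd≡1⇒coprime (ℤ.+-injective (trans (sym (rho-gcd {m} {M} z≤n z≤n (ℕ.>-nonZero⁻¹ m))) gcd≡1)))
  rhoCond₁⇒coprime {m} {M} (suc zero , _ , gcd≡1) =
    inj₂ (gcd≡1⇒coprime (ℤ.+-injective (trans (sym (rho-gcd {m} {M} ℕ.≤-refl (ℕ.>-nonZero⁻¹ M) z≤n)) gcd≡1)))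
  rhoCond₁⇒coprime (suc (suc _) , s≤s () , _)

open import Data.Nat using (ℕ; NonZero; _+_; _∸_)

proposition3p5 : (m M : ℕ) → NonZero m → NonZero M →
    RhoIs m M 1 → DavenportIs m M (m + M ∸ 1)
proposition3p5 m M m≢0 M≢0 (rhoCond₁ , rho-least) =
  long-minimal-sequence ⦃ m≢0 ⦄ ⦃ M≢0 ⦄ (rhoCond₁⇒coprime ⦃ m≢0 ⦄ ⦃ M≢0 ⦄ rhoCond₁) ,
  λ _ → gcd≢1⇒length≤ ⦃ m≢0 ⦄ ⦃ M≢0 ⦄ (¬rhoCond₀⇒gcd≢1 (rho-least 0 (s≤s z≤n)))
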